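{- Let $\Gamma$ be a non-complete $2$-arc-transitive strongly regular graph. Then either $\Gamma$ is a complete bipartite graph, or $\Gamma\cong C_5$, or $|\Gamma(u)|<|\Gamma_2(u)|$ for each vertex $u$.
   Context: A strongly regular graph with parameters $(n,k,a,c)$ is a connected $k$-regular graph on $n$ vertices in which adjacent vertices have $a$ common neighbours and distinct non-adjacent vertices have $c$ common neighbours. $\Gamma$ is $2$-arc-transitive if $\mathrm{Aut}(\Gamma)$ is transitive on vertices, on arcs, and on $2$-arcs (sequences $(v_0,v_1,v_2)$ with $v_0\sim v_1\sim v_2$, $v_0\ne v_2$). $\Gamma(u)$ and $\Gamma_2(u)$ denote the sets of vertices at distance $1$ and $2$ from $u$. -}

module Defs where

open import Data.Nat using (ℕ; _+_; _%_; _≡ᵇ_; _<_)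
open import Data.Bool using (Bool; true; false; _∨_)
open import Data.Fin using (Fin; toℕ; _≟_; zero; suc)
open import Data.Fin.Properties using (any?)
open import Data.Fin.Permutation using (Permutation; Permutation′; _⟨$⟩ʳ_)
open import Data.List using (List; length; filter; allFin)
open import Data.Product using (Σ; ∃; ∃-syntax; _×_; _,_)
open import Data.Bool.Properties using (∨-comm) renaming (_≟_ to _≟ᵇ_)
open import Relation.Nullary using (¬_; Dec; ¬?)
open import Relation.Nullary.Decidable using (_×-dec_)
open import Relation.Binary.PropositionalEquality using (_≡_; _≢_; refl)
open import Relation.Binary.Construct.Closure.ReflexiveTransitive using (Star)

record Graph : Set where
  field
    n      : ℕ
    adj    : Fin n → Fin n → Bool
    sym    : ∀ x y → adj x y ≡ adj y x
    irrefl : ∀ x → adj x x ≡ false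

open Graph public

module _ (Γ : Graph) where
  V : Set
  V = Fin (n Γ)

  Adj : V → V → Set
  Adj x y = adj Γ x y ≡ true

  adj? : ∀ x y → Dec (Adj x y)
  adj? x y = adj Γ x y ≟ᵇ true

  count : {P : V → Set} → (∀ x → Dec (P x)) → ℕ
  count P? = length (filter P? (allFin (n Γ)))

  Connected : Set
  Connected = ∀ x y → Star Adj x y

  InΓ₁ : V → V → Set
  InΓ₁ u v = Adj u v

  InΓ₂ : V → V → Set
  InΓ₂ u v = u ≢ v × ¬ Adj u v × ∃[ w ] (Adj u w × Adj w v)

  inΓ₂? : ∀ u v → Dec (InΓ₂ u v)
  inΓ₂? u v = ¬? (u ≟ v) ×-dec (¬? (adj? u v) ×-dec any? (λ w → adj? u w ×-dec adj? w v))

  |Γ₁| : V → ℕ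
  |Γ₁| u = count (adj? u)

  |Γ₂| : V → ℕ
  |Γ₂| u = count (inΓ₂? u)

  commonNbrs : V → V → ℕ
  commonNbrs x y = count (λ w → adj? x w ×-dec adj? y w)

  IsSRG : ℕ → ℕ → ℕ → Set
  IsSRG k a c =
    Connected
    × (∀ u → |Γ₁| u ≡ k)
    × (∀ x y → Adj x y → commonNbrs x y ≡ a)
    × (∀ x y → x ≢ y → ¬ Adj x y → commonNbrs x y ≡ c)

  StronglyRegular : Set
  StronglyRegular = ∃[ k ] ∃[ a ] ∃[ c ] IsSRG k a c

  NonComplete : Set
  NonComplete = ∃[ x ] ∃[ y ] (x ≢ y × ¬ Adj x y)

  IsAut : Permutation′ (n Γ) → Set
  IsAut σ = ∀ x y → adj Γ (σ ⟨$⟩ʳ x) (σ ⟨$⟩ʳ y) ≡ adj Γ x y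

  Aut : Set
  Aut = Σ (Permutation′ (n Γ)) IsAut

  Is2Arc : V → V → V → Set
  Is2Arc v₀ v₁ v₂ = Adj v₀ v₁ × Adj v₁ v₂ × v₀ ≢ v₂

  VertexTransitive : Set
  VertexTransitive = ∀ u v → ∃[ σ ] (IsAut σ × σ ⟨$⟩ʳ u ≡ v)

  ArcTransitive : Set
  ArcTransitive = ∀ u₀ u₁ v₀ v₁ → Adj u₀ u₁ → Adj v₀ v₁ →
    ∃[ σ ] (IsAut σ × σ ⟨$⟩ʳ u₀ ≡ v₀ × σ ⟨$⟩ʳ u₁ ≡ v₁)

  TwoArcTransitiveOn : Set
  TwoArcTransitiveOn = ∀ u₀ u₁ u₂ v₀ v₁ v₂ → Is2Arc u₀ u₁ u₂ → Is2Arc v₀ v₁ v₂ →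
    ∃[ σ ] (IsAut σ × σ ⟨$⟩ʳ u₀ ≡ v₀ × σ ⟨$⟩ʳ u₁ ≡ v₁ × σ ⟨$⟩ʳ u₂ ≡ v₂)

  TwoArcTransitive : Set
  TwoArcTransitive = VertexTransitive × ArcTransitive × TwoArcTransitiveOn

  CompleteBipartite : Set
  CompleteBipartite = Σ (V → Bool) λ part →
    (∃[ x ] part x ≡ true) × (∃[ y ] part y ≡ false)
    × (∀ x y → (Adj x y → part x ≢ part y) × (part x ≢ part y → Adj x y))

_≅_ : Graph → Graph → Set
Γ ≅ Δ = Σ (Permutation (n Γ) (n Δ)) λ f → ∀ x y → adj Δ (f ⟨$⟩ʳ x) (f ⟨$⟩ʳ y) ≡ adj Γ x y

c5adj : Fin 5 → Fin 5 → Bool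
c5adj i j = ((toℕ i + 1) % 5 ≡ᵇ toℕ j) ∨ ((toℕ j + 1) % 5 ≡ᵇ toℕ i)

C₅ : Graph
C₅ = record { n = 5 ; adj = c5adj ; sym = s ; irrefl = r }
  where
  s : ∀ x y → c5adj x y ≡ c5adj y x
  s x y = ∨-comm ((toℕ x + 1) % 5 ≡ᵇ toℕ y) _
  r : ∀ x → c5adj x x ≡ false
  r zero = refl
  r (suc zero) = refl
  r (suc (suc zero)) = refl
  r (suc (suc (suc zero))) = refl
  r (suc (suc (suc (suc zero)))) = refl

{-# OPTIONS --safe #-}
-- A triangle would, by 2-arc-transitivity, close every 2-arc into a triangle, and a connected
-- graph in which every 2-arc closes is complete; so Γ is triangle-free.
-- If c = k, non-adjacent vertices are twins and Γ is complete bipartite. If c = k − 1, a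
-- neighbour b of y₀ outside Γ(x₀) makes the common neighbourhoods of {x₀, y₀} and {x₀, b}
-- disjoint inside Γ(x₀), so 2c ≤ k, hence c = 1, k = 2 and Γ is the pentagon. Otherwise,
-- counting the edges between Γ(u) and Γ₂(u) gives |Γ₂(u)| c = k (k − 1) with c ≤ k − 2,
-- so |Γ₂(u)| > k.
module Submission where

open import Defs
open import Data.Nat using (_<_)
open import Data.Sum using (_⊎_)

open import Data.Bool using (true; false)
open import Data.Bool.Properties using (¬-not; not-¬) renaming (_≟_ to _≟ᵇ_)
open import Data.Empty using (⊥; ⊥-elim)
open import Data.Fin using (Fin; zero; suc; _≟_)
open import Data.Fin.Permutation using (permutation)
open import Data.Fin.Properties using (all?; any?)
open import Data.List using (List; []; _∷_; length; filter; map; allFin)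
open import Data.List.Membership.Propositional using (_∈_)
open import Data.List.Membership.Propositional.Properties using (∈-allFin)
open import Data.List.Properties using (filter-≐; filter-some; filter-none; filter-accept; filter-reject)
import Data.List.Relation.Unary.All as All
import Data.List.Relation.Unary.Any as Any
open import Data.List.Relation.Unary.Any using (here; there)
open import Data.List.Relation.Unary.AllPairs using (_∷_)
open import Data.List.Relation.Unary.Unique.Propositional using (Unique)
open import Data.List.Relation.Unary.Unique.Propositional.Properties using (allFin⁺)
open import Data.Nat using (ℕ; suc; _+_; _*_; _∸_; _≤_; z≤n; s≤s)
open import Data.Nat.ListAction using (sum)
open import Data.Nat.Properties hiding (_≟_)
open import Algebra.Properties.CommutativeSemigroup +-commutativeSemigroup using (x∙yz≈y∙xz)
open import Data.Product using (∃; ∃-syntax; _×_; _,_; proj₁; proj₂)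
open import Data.Sum using (inj₁; inj₂; [_,_])
open import Relation.Binary.Construct.Closure.ReflexiveTransitive using (Star; ε; _◅_)
open import Relation.Binary.Definitions using (DecidableEquality)
open import Relation.Binary.PropositionalEquality
  using (_≡_; _≢_; refl; trans; cong; cong₂; subst; subst₂; ≢-sym)
import Relation.Binary.PropositionalEquality as ≡
open import Relation.Nullary using (¬_; Dec; yes; no; ¬?; contradiction)
open import Relation.Nullary.Decidable using (from-yes; _×-dec_; _⊎-dec_; _→-dec_)
open import Relation.Unary using (Decidable; _⊆_; _≐_)
open import Relation.Unary.Properties using (_∩?_; ∁?)

module _ {A : Set} where

  countIn : {P : A → Set} → Decidable P → List A → ℕ
  countIn P? xs = length (filter P? xs)

  countIn-cong : ∀ {P Q} (P? : Decidable P) (Q? : Decidable Q) → P ≐ Q →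
    ∀ xs → countIn P? xs ≡ countIn Q? xs
  countIn-cong P? Q? P≐Q xs = cong length (filter-≐ P? Q? P≐Q xs)

  countIn-split : ∀ {P Q} (P? : Decidable P) (Q? : Decidable Q) →
    ∀ xs → countIn P? xs ≡ countIn (P? ∩? Q?) xs + countIn (P? ∩? ∁? Q?) xs
  countIn-split P? Q? [] = refl
  countIn-split P? Q? (x ∷ xs) with P? x | Q? x
  ... | yes _ | yes _ = cong suc (countIn-split P? Q? xs)
  ... | yes _ | no _  = trans (cong suc (countIn-split P? Q? xs)) (≡.sym (+-suc _ _))
  ... | no _  | _     = countIn-split P? Q? xs

  countIn-⊆ : ∀ {P Q} (P? : Decidable P) (Q? : Decidable Q) → P ⊆ Q →
    ∀ xs → countIn P? xs ≡ countIn (Q? ∩? P?) xs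
  countIn-⊆ P? Q? P⊆Q = countIn-cong P? (Q? ∩? P?) ((λ p → P⊆Q p , p) , proj₂)

  countIn-mono : ∀ {P Q} (P? : Decidable P) (Q? : Decidable Q) → P ⊆ Q →
    ∀ xs → countIn P? xs ≤ countIn Q? xs
  countIn-mono P? Q? P⊆Q xs = begin
    countIn P? xs                                     ≡⟨ countIn-⊆ P? Q? P⊆Q xs ⟩
    countIn (Q? ∩? P?) xs                             ≤⟨ m≤m+n _ _ ⟩
    countIn (Q? ∩? P?) xs + countIn (Q? ∩? ∁? P?) xs  ≡⟨ countIn-split Q? P? xs ⟨
    countIn Q? xs                                     ∎
    where open ≤-Reasoning

  countIn-disjoint : ∀ {P Q R} (P? : Decidable P) (Q? : Decidable Q) (R? : Decidable R) →
    P ⊆ R → Q ⊆ R → (∀ {x} → P x → Q x → ⊥) →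
    ∀ xs → countIn P? xs + countIn Q? xs ≤ countIn R? xs
  countIn-disjoint P? Q? R? P⊆R Q⊆R disjoint xs = begin
    countIn P? xs + countIn Q? xs
      ≡⟨ cong (_+ countIn Q? xs) (countIn-⊆ P? R? P⊆R xs) ⟩
    countIn (R? ∩? P?) xs + countIn Q? xs
      ≤⟨ +-monoʳ-≤ _ (countIn-mono Q? (R? ∩? ∁? P?) (λ q → Q⊆R q , λ p → disjoint p q) xs) ⟩
    countIn (R? ∩? P?) xs + countIn (R? ∩? ∁? P?) xs
      ≡⟨ countIn-split R? P? xs ⟨
    countIn R? xs ∎
    where open ≤-Reasoning

  countIn-filter : ∀ {P Q} (P? : Decidable P) (Q? : Decidable Q) →
    ∀ xs → countIn Q? (filter P? xs) ≡ countIn (P? ∩? Q?) xs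
  countIn-filter P? Q? [] = refl
  countIn-filter P? Q? (x ∷ xs) with P? x
  ... | no _ = countIn-filter P? Q? xs
  ... | yes _ with Q? x
  ...   | yes _ = cong suc (countIn-filter P? Q? xs)
  ...   | no _  = countIn-filter P? Q? xs

  countIn-≟-unique : (_≟ᴬ_ : DecidableEquality A) → ∀ {a xs} → Unique xs → a ∈ xs →
    countIn (_≟ᴬ a) xs ≡ 1
  countIn-≟-unique _≟ᴬ_ (x∉xs ∷ _) (here refl) = cong length (trans
    (filter-accept (_≟ᴬ _) refl)
    (cong (_ ∷_) (filter-none (_≟ᴬ _) (All.map ≢-sym x∉xs))))
  countIn-≟-unique _≟ᴬ_ (x∉xs ∷ xs-unique) (there a∈xs) = trans
    (cong length (filter-reject (_≟ᴬ _) (All.lookup x∉xs a∈xs)))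
    (countIn-≟-unique _≟ᴬ_ xs-unique a∈xs)

  sum-map-filter : ∀ {P} (P? : Decidable P) (f : A → ℕ) {m} → (∀ {x} → P x → f x ≡ m) →
    ∀ xs → sum (map f (filter P? xs)) ≡ countIn P? xs * m
  sum-map-filter P? f f≡m [] = refl
  sum-map-filter P? f f≡m (x ∷ xs) with P? x
  ... | yes px = cong₂ _+_ (f≡m px) (sum-map-filter P? f f≡m xs)
  ... | no _   = sum-map-filter P? f f≡m xs

module _ {A B : Set} {R : A → B → Set} (R? : ∀ x y → Dec (R x y)) where

  double-count : ∀ xs ys →
    sum (map (λ x → countIn (R? x) ys) xs) ≡ sum (map (λ y → countIn (λ x → R? x y) xs) ys)
  double-count [] ys = ≡.sym (no-rows ys)
    where
    no-rows : ∀ ys → sum (map (λ y → countIn (λ x → R? x y) []) ys) ≡ 0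
    no-rows []       = refl
    no-rows (_ ∷ ys) = no-rows ys
  double-count (x ∷ xs) ys = trans (cong (countIn (R? x) ys +_) (double-count xs ys)) (add-row ys)
    where
    column : B → List A → ℕ
    column y = countIn (λ x′ → R? x′ y)
    add-row : ∀ ys → countIn (R? x) ys + sum (map (λ y → column y xs) ys)
                     ≡ sum (map (λ y → column y (x ∷ xs)) ys)
    add-row-under : ∀ y ys →
      countIn (R? x) ys + (column y xs + sum (map (λ y → column y xs) ys))
        ≡ column y xs + sum (map (λ y → column y (x ∷ xs)) ys)
    add-row [] = refl
    add-row (y ∷ ys) with R? x y
    ... | yes _ = cong suc (add-row-under y ys)
    ... | no _  = add-row-under y ys
    add-row-under y ys = trans (x∙yz≈y∙xz (countIn (R? x) ys) (column y xs) _)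
                               (cong (column y xs +_) (add-row ys))

module _ {N : ℕ} where

  countFin : {P : Fin N → Set} → Decidable P → ℕ
  countFin P? = countIn P? (allFin N)

  countFin-pos : ∀ {P} (P? : Decidable P) {a} → P a → 0 < countFin P?
  countFin-pos {P} P? pa = filter-some P? (Any.map (λ a≡x → subst P a≡x pa) (∈-allFin _))

  countFin-witness : ∀ {P} (P? : Decidable P) → 0 < countFin P? → ∃ P
  countFin-witness P? pos with any? P?
  ... | yes ∃P = ∃P
  ... | no ∄P = contradiction
    (cong length (filter-none P? {allFin N} (All.tabulate λ {x} _ px → ∄P (x , px))))
    (>⇒≢ pos)

  countFin-remove : ∀ {P} (P? : Decidable P) {a} → P a →
    countFin P? ≡ suc (countFin (P? ∩? ∁? (_≟ a)))
  countFin-remove P? {a} pa = begin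
    countFin P?                                           ≡⟨ countIn-split P? (_≟ a) (allFin N) ⟩
    countFin (P? ∩? (_≟ a)) + countFin (P? ∩? ∁? (_≟ a))  ≡⟨ cong (_+ countFin (P? ∩? ∁? (_≟ a))) only-a ⟩
    suc (countFin (P? ∩? ∁? (_≟ a)))                      ∎
    where
    open ≡.≡-Reasoning
    only-a : countFin (P? ∩? (_≟ a)) ≡ 1
    only-a = trans (countIn-cong (P? ∩? (_≟ a)) (_≟ a) (proj₂ , λ { refl → pa , refl }) (allFin N))
                   (countIn-≟-unique _≟_ (allFin⁺ N) (∈-allFin a))

  countFin-remove-≡ : ∀ {P} (P? : Decidable P) {a m} → P a → countFin P? ≡ suc m →
    countFin (P? ∩? ∁? (_≟ a)) ≡ m
  countFin-remove-≡ P? pa eq = suc-injective (trans (≡.sym (countFin-remove P? pa)) eq)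

  countFin-≡1⇒unique : ∀ {P} (P? : Decidable P) → countFin P? ≡ 1 →
    ∀ {a b} → P a → P b → b ≡ a
  countFin-≡1⇒unique P? one {a} {b} pa pb with b ≟ a
  ... | yes b≡a = b≡a
  ... | no b≢a  = contradiction (countFin-remove-≡ P? pa one)
                                (>⇒≢ (countFin-pos (P? ∩? ∁? (_≟ a)) (pb , b≢a)))

  countFin-≡2⇒pair : ∀ {P} (P? : Decidable P) → countFin P? ≡ 2 →
    ∀ {a b z} → P a → P b → b ≢ a → P z → z ≡ a ⊎ z ≡ b
  countFin-≡2⇒pair P? two {a} {z = z} pa pb b≢a pz with z ≟ a
  ... | yes z≡a = inj₁ z≡a
  ... | no z≢a  = inj₂ (countFin-≡1⇒unique (P? ∩? ∁? (_≟ a)) (countFin-remove-≡ P? pa two)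
                                           (pb , b≢a) (pz , z≢a))

  countFin-≡2⇒other : ∀ {P} (P? : Decidable P) → countFin P? ≡ 2 →
    ∀ {a} → P a → ∃[ b ] P b × b ≢ a
  countFin-≡2⇒other P? two pa =
    countFin-witness (P? ∩? ∁? (_≟ _)) (≤-reflexive (≡.sym (countFin-remove-≡ P? pa two)))

  countFin-≤⇒⊇ : ∀ {P Q} (P? : Decidable P) (Q? : Decidable Q) → P ⊆ Q →
    countFin Q? ≤ countFin P? → Q ⊆ P
  countFin-≤⇒⊇ P? Q? P⊆Q Q≤P {z} qz with P? z
  ... | yes pz = pz
  ... | no ¬pz = contradiction Q≤P (<⇒≱ (begin-strict
    countFin P?                                     ≡⟨ countIn-⊆ P? Q? P⊆Q (allFin N) ⟩
    countFin (Q? ∩? P?)                             <⟨ m<m+n _ (countFin-pos (Q? ∩? ∁? P?) (qz , ¬pz)) ⟩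
    countFin (Q? ∩? P?) + countFin (Q? ∩? ∁? P?)    ≡⟨ countIn-split Q? P? (allFin N) ⟨
    countFin Q?                                     ∎))
    where open ≤-Reasoning

next : Fin 5 → Fin 5
next zero                          = suc zero
next (suc zero)                    = suc (suc zero)
next (suc (suc zero))              = suc (suc (suc zero))
next (suc (suc (suc zero)))        = suc (suc (suc (suc zero)))
next (suc (suc (suc (suc zero))))  = zero

C₅-edge : ∀ i j → c5adj i j ≡ true → j ≡ next i ⊎ i ≡ next j
C₅-edge = from-yes (all? λ i → all? λ j →
  (c5adj i j ≟ᵇ true) →-dec (j ≟ next i ⊎-dec i ≟ next j))

C₅-nonEdge : ∀ i j → c5adj i j ≡ false → i ≡ j ⊎ ∃[ k ] c5adj i k ≡ true × c5adj k j ≡ true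
C₅-nonEdge = from-yes (all? λ i → all? λ j →
  (c5adj i j ≟ᵇ false) →-dec (i ≟ j ⊎-dec any? λ k → (c5adj i k ≟ᵇ true) ×-dec (c5adj k j ≟ᵇ true)))

C₅-twinFree : ∀ i j → i ≡ j ⊎ ∃[ k ] c5adj i k ≢ c5adj j k
C₅-twinFree = from-yes (all? λ i → all? λ j → i ≟ j ⊎-dec any? λ k → ¬? (c5adj i k ≟ᵇ c5adj j k))

TriangleFree : Graph → Set
TriangleFree Γ = ∀ {x y z} → Adj Γ x y → Adj Γ y z → Adj Γ x z → ⊥

TwoArcsCloseAt : (Γ : Graph) → V Γ → Set
TwoArcsCloseAt Γ x = ∀ {p q} → Adj Γ x p → Adj Γ p q → x ≢ q → Adj Γ x q

record SpanningPentagon (Γ : Graph) : Set where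
  field
    corner : Fin 5 → V Γ
    side   : ∀ i → Adj Γ (corner i) (corner (next i))
    spans  : ∀ v → ∃[ i ] corner i ≡ v

module GraphProperties (Γ : Graph) where

  Adj-sym : ∀ {x y} → Adj Γ x y → Adj Γ y x
  Adj-sym {x} {y} x~y = trans (sym Γ y x) x~y

  Adj⇒≢ : ∀ {x y} → Adj Γ x y → x ≢ y
  Adj⇒≢ {x} x~x refl = not-¬ (irrefl Γ x) x~x

  connected⇒edge : Connected Γ → NonComplete Γ → ∃[ x ] ∃[ y ] Adj Γ x y
  connected⇒edge conn (x , y , x≢y , _) with conn x y
  ... | ε         = contradiction refl x≢y
  ... | x~z ◅ _   = x , _ , x~z

  twoArcsClose-along : ∀ {x} → TwoArcsCloseAt Γ x →
    ∀ {v w} → Star (Adj Γ) v w → x ≡ v ⊎ Adj Γ x v → x ≡ w ⊎ Adj Γ x w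
  twoArcsClose-along closes ε x≃v = x≃v
  twoArcsClose-along closes (v~u ◅ path) (inj₁ refl) = twoArcsClose-along closes path (inj₂ v~u)
  twoArcsClose-along {x} closes (_◅_ {j = u} v~u path) (inj₂ x~v) with x ≟ u
  ... | yes x≡u = twoArcsClose-along closes path (inj₁ x≡u)
  ... | no x≢u  = twoArcsClose-along closes path (inj₂ (closes x~v v~u x≢u))

  twoArcsClose⇒adjacent : Connected Γ → ∀ {x} → TwoArcsCloseAt Γ x → ∀ {y} → x ≢ y → Adj Γ x y
  twoArcsClose⇒adjacent conn {x} closes {y} x≢y with twoArcsClose-along closes (conn x y) (inj₁ refl)
  ... | inj₁ x≡y = contradiction x≡y x≢y
  ... | inj₂ x~y = x~y

  nonComplete⇒¬twoArcsClose : Connected Γ → NonComplete Γ → ¬ (∀ x → TwoArcsCloseAt Γ x)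
  nonComplete⇒¬twoArcsClose conn (x , _ , x≢y , x≁y) closes =
    x≁y (twoArcsClose⇒adjacent conn (closes x) x≢y)

  triangle⇒twoArcsClose : TwoArcTransitiveOn Γ → ∀ {x y z} →
    Adj Γ x y → Adj Γ y z → Adj Γ x z → ∀ u → TwoArcsCloseAt Γ u
  triangle⇒twoArcsClose arcTrans {x} {y} {z} x~y y~z x~z u u~p p~q u≢q
    with arcTrans x y z u _ _ (x~y , y~z , Adj⇒≢ x~z) (u~p , p~q , u≢q)
  ... | σ , σ-aut , refl , _ , refl = trans (σ-aut x z) x~z

  twoArcTransitive⇒triangleFree : Connected Γ → NonComplete Γ → TwoArcTransitiveOn Γ →
    TriangleFree Γ
  twoArcTransitive⇒triangleFree conn nc arcTrans x~y y~z x~z =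
    nonComplete⇒¬twoArcsClose conn nc (triangle⇒twoArcsClose arcTrans x~y y~z x~z)

  twins⇒completeBipartite : TriangleFree Γ →
    (∀ {x y} → x ≢ y → ¬ Adj Γ x y → Adj Γ x ⊆ Adj Γ y) →
    ∀ {x₀ y₀} → Adj Γ x₀ y₀ → CompleteBipartite Γ
  twins⇒completeBipartite triangleFree twins {x₀} {y₀} x₀~y₀ =
    adj Γ x₀ , (y₀ , x₀~y₀) , (x₀ , irrefl Γ x₀) , λ x y → edge-crosses x y , crossing-is-edge x y
    where
    twin : ∀ {v} → adj Γ x₀ v ≡ false → Adj Γ x₀ ≐ Adj Γ v
    twin {v} x₀≁v with v ≟ x₀
    ... | yes refl = (λ h → h) , (λ h → h)
    ... | no v≢x₀  = twins (≢-sym v≢x₀) (not-¬ x₀≁v) , twins v≢x₀ (λ v~x₀ → not-¬ x₀≁v (Adj-sym v~x₀))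

    edge-crosses : ∀ x y → Adj Γ x y → adj Γ x₀ x ≢ adj Γ x₀ y
    edge-crosses x y x~y same with adj Γ x₀ x in x₀x
    ... | true  = triangleFree x₀x x~y (≡.sym same)
    ... | false = not-¬ (≡.sym same) (proj₂ (twin x₀x) x~y)

    crossing-is-edge : ∀ x y → adj Γ x₀ x ≢ adj Γ x₀ y → Adj Γ x y
    crossing-is-edge x y differ with adj Γ x₀ x in x₀x | adj Γ x₀ y in x₀y
    ... | true  | true  = contradiction refl differ
    ... | false | false = contradiction refl differ
    ... | true  | false = Adj-sym (proj₁ (twin x₀y) x₀x)
    ... | false | true  = proj₁ (twin x₀x) x₀y

  -- Non-adjacent corners have a common neighbour on the pentagon, so triangle-freeness keeps
  -- them non-adjacent in Γ; as C₅ is twin-free, the corners are pairwise distinct.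
  spanningPentagon⇒≅C₅ : TriangleFree Γ → SpanningPentagon Γ → Γ ≅ C₅
  spanningPentagon⇒≅C₅ triangleFree pentagon =
    permutation index corner index∘corner corner∘index , λ x y →
      trans (≡.sym (adj-corner (index x) (index y))) (cong₂ (adj Γ) (corner∘index x) (corner∘index y))
    where
    open SpanningPentagon pentagon
    index : V Γ → Fin 5
    index v = proj₁ (spans v)

    corner∘index : ∀ v → corner (index v) ≡ v
    corner∘index v = proj₂ (spans v)

    edge : ∀ {i j} → c5adj i j ≡ true → Adj Γ (corner i) (corner j)
    edge {i} {j} e with C₅-edge i j e
    ... | inj₁ refl = side i
    ... | inj₂ refl = Adj-sym (side j)

    adj-corner : ∀ i j → adj Γ (corner i) (corner j) ≡ c5adj i j
    adj-corner i j with c5adj i j in e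
    ... | true  = edge e
    ... | false with C₅-nonEdge i j e
    ...   | inj₁ refl           = irrefl Γ (corner i)
    ...   | inj₂ (k , ik , kj)  = ¬-not (triangleFree (edge ik) (edge kj))

    corner-injective : ∀ {i j} → corner i ≡ corner j → i ≡ j
    corner-injective {i} {j} same with C₅-twinFree i j
    ... | inj₁ i≡j        = i≡j
    ... | inj₂ (k , differ) = contradiction
      (trans (≡.sym (adj-corner i k)) (trans (cong (λ v → adj Γ v (corner k)) same) (adj-corner j k)))
      differ

    index∘corner : ∀ i → index (corner i) ≡ i
    index∘corner i = corner-injective (corner∘index (corner i))

module SRGProperties (Γ : Graph) {k c : ℕ} (connected : Connected Γ)
  (regular : ∀ u → |Γ₁| Γ u ≡ k)
  (nonAdjacent-common : ∀ x y → x ≢ y → ¬ Adj Γ x y → commonNbrs Γ x y ≡ c) where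

  open GraphProperties Γ

  common-neighbour : 0 < c → ∀ {x y} → x ≢ y → ¬ Adj Γ x y → ∃[ w ] Adj Γ x w × Adj Γ y w
  common-neighbour 0<c {x} {y} x≢y x≁y = countFin-witness (adj? Γ x ∩? adj? Γ y)
    (subst (0 <_) (≡.sym (nonAdjacent-common x y x≢y x≁y)) 0<c)

  c-positive : NonComplete Γ → 0 < c
  c-positive nc = n≢0⇒n>0 λ c≡0 → nonComplete⇒¬twoArcsClose connected nc (closes c≡0)
    where
    closes : c ≡ 0 → ∀ x → TwoArcsCloseAt Γ x
    closes c≡0 x {p} {q} x~p p~q x≢q with adj? Γ x q
    ... | yes x~q = x~q
    ... | no x≁q  = contradiction (trans (nonAdjacent-common x q x≢q x≁q) c≡0)
                                  (>⇒≢ (countFin-pos (adj? Γ x ∩? adj? Γ q) (x~p , Adj-sym p~q)))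

  c≤k : NonComplete Γ → c ≤ k
  c≤k (x , y , x≢y , x≁y) = subst₂ _≤_ (nonAdjacent-common x y x≢y x≁y) (regular x)
    (countIn-mono (adj? Γ x ∩? adj? Γ y) (adj? Γ x) proj₁ (allFin _))

  c≡k⇒twins : c ≡ k → ∀ {x y} → x ≢ y → ¬ Adj Γ x y → Adj Γ x ⊆ Adj Γ y
  c≡k⇒twins c≡k {x} {y} x≢y x≁y x~z = proj₂
    (countFin-≤⇒⊇ (adj? Γ x ∩? adj? Γ y) (adj? Γ x) proj₁
      (≤-reflexive (trans (regular x) (≡.sym (trans (nonAdjacent-common x y x≢y x≁y) c≡k))))
      x~z)

  k≡1+c⇒c≡1 : TriangleFree Γ → NonComplete Γ → k ≡ suc c → c ≡ 1
  k≡1+c⇒c≡1 triangleFree nc@(x₀ , y₀ , x₀≢y₀ , x₀≁y₀) k≡1+c =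
    ≤-antisym (+-cancelˡ-≤ c c 1 (c+c≤c+1 y₀-private-neighbour)) (c-positive nc)
    where
    open ≤-Reasoning
    y₀-private : countFin (adj? Γ y₀ ∩? ∁? (adj? Γ x₀)) ≡ 1
    y₀-private = +-cancelˡ-≡ c _ _ (begin-equality
      c + countFin (adj? Γ y₀ ∩? ∁? (adj? Γ x₀))
        ≡⟨ cong (_+ _) (nonAdjacent-common y₀ x₀ (≢-sym x₀≢y₀) (λ y₀~x₀ → x₀≁y₀ (Adj-sym y₀~x₀))) ⟨
      countFin (adj? Γ y₀ ∩? adj? Γ x₀) + countFin (adj? Γ y₀ ∩? ∁? (adj? Γ x₀))
        ≡⟨ countIn-split (adj? Γ y₀) (adj? Γ x₀) (allFin _) ⟨
      |Γ₁| Γ y₀  ≡⟨ trans (regular y₀) k≡1+c ⟩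
      suc c      ≡⟨ +-comm 1 c ⟩
      c + 1      ∎)

    y₀-private-neighbour : ∃[ b ] Adj Γ y₀ b × ¬ Adj Γ x₀ b
    y₀-private-neighbour =
      countFin-witness (adj? Γ y₀ ∩? ∁? (adj? Γ x₀)) (≤-reflexive (≡.sym y₀-private))

    c+c≤c+1 : ∃[ b ] Adj Γ y₀ b × ¬ Adj Γ x₀ b → c + c ≤ c + 1
    c+c≤c+1 (b , y₀~b , x₀≁b) = begin
      c + c
        ≡⟨ cong₂ _+_ (nonAdjacent-common x₀ y₀ x₀≢y₀ x₀≁y₀)
                     (nonAdjacent-common x₀ b (λ x₀≡b → x₀≁y₀ (Adj-sym (subst (Adj Γ y₀) (≡.sym x₀≡b) y₀~b))) x₀≁b) ⟨
      commonNbrs Γ x₀ y₀ + commonNbrs Γ x₀ b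
        ≤⟨ countIn-disjoint (adj? Γ x₀ ∩? adj? Γ y₀) (adj? Γ x₀ ∩? adj? Γ b) (adj? Γ x₀) proj₁ proj₁
             (λ (_ , y₀~w) (_ , b~w) → triangleFree y₀~b b~w y₀~w) (allFin _) ⟩
      |Γ₁| Γ x₀  ≡⟨ trans (regular x₀) k≡1+c ⟩
      suc c      ≡⟨ +-comm 1 c ⟩
      c + 1      ∎

  -- In a triangle-free graph every neighbour of w other than u lies in Γ₂(u).
  Γ₂-neighbours : TriangleFree Γ → ∀ {u w} → Adj Γ u w →
    suc (countFin (inΓ₂? Γ u ∩? λ x → adj? Γ x w)) ≡ k
  Γ₂-neighbours triangleFree {u} {w} u~w = begin
    suc (countFin (inΓ₂? Γ u ∩? λ x → adj? Γ x w))
      ≡⟨ cong suc (countIn-cong (adj? Γ w ∩? ∁? (_≟ u)) _ (into-Γ₂ , out-of-Γ₂) (allFin _)) ⟨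
    suc (countFin (adj? Γ w ∩? ∁? (_≟ u)))
      ≡⟨ countFin-remove (adj? Γ w) (Adj-sym u~w) ⟨
    |Γ₁| Γ w  ≡⟨ regular w ⟩
    k         ∎
    where
    open ≡.≡-Reasoning
    into-Γ₂ : ∀ {x} → Adj Γ w x × x ≢ u → InΓ₂ Γ u x × Adj Γ x w
    into-Γ₂ (w~x , x≢u) =
      (≢-sym x≢u , (λ u~x → triangleFree u~w w~x u~x) , w , u~w , w~x) , Adj-sym w~x
    out-of-Γ₂ : ∀ {x} → InΓ₂ Γ u x × Adj Γ x w → Adj Γ w x × x ≢ u
    out-of-Γ₂ ((u≢x , _) , x~w) = Adj-sym x~w , ≢-sym u≢x

  |Γ₂|*c≡k*[k∸1] : TriangleFree Γ → ∀ u → |Γ₂| Γ u * c ≡ k * (k ∸ 1)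
  |Γ₂|*c≡k*[k∸1] triangleFree u = begin
    |Γ₂| Γ u * c
      ≡⟨ sum-map-filter (inΓ₂? Γ u) _ edges-from-Γ₂ (allFin _) ⟨
    sum (map (λ x → countIn (adj? Γ x) Γ₁-list) Γ₂-list)
      ≡⟨ double-count (adj? Γ) Γ₂-list Γ₁-list ⟩
    sum (map (λ w → countIn (λ x → adj? Γ x w) Γ₂-list) Γ₁-list)
      ≡⟨ sum-map-filter (adj? Γ u) _ edges-from-Γ₁ (allFin _) ⟩
    |Γ₁| Γ u * (k ∸ 1)
      ≡⟨ cong (_* (k ∸ 1)) (regular u) ⟩
    k * (k ∸ 1) ∎
    where
    open ≡.≡-Reasoning
    Γ₁-list Γ₂-list : List (V Γ)
    Γ₁-list = filter (adj? Γ u) (allFin (n Γ))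
    Γ₂-list = filter (inΓ₂? Γ u) (allFin (n Γ))
    edges-from-Γ₂ : ∀ {x} → InΓ₂ Γ u x → countIn (adj? Γ x) Γ₁-list ≡ c
    edges-from-Γ₂ {x} (u≢x , u≁x , _) =
      trans (countIn-filter (adj? Γ u) (adj? Γ x) (allFin _)) (nonAdjacent-common u x u≢x u≁x)
    edges-from-Γ₁ : ∀ {w} → Adj Γ u w → countIn (λ x → adj? Γ x w) Γ₂-list ≡ k ∸ 1
    edges-from-Γ₁ {w} u~w = trans (countIn-filter (inΓ₂? Γ u) (λ x → adj? Γ x w) (allFin _))
                                  (cong (_∸ 1) (Γ₂-neighbours triangleFree u~w))

  module _ (triangleFree : TriangleFree Γ) (k≡2 : k ≡ 2) (c≡1 : c ≡ 1) where

    neighbours : ∀ {u a b z} → Adj Γ u a → Adj Γ u b → b ≢ a → Adj Γ u z → z ≡ a ⊎ z ≡ b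
    neighbours {u} = countFin-≡2⇒pair (adj? Γ u) (trans (regular u) k≡2)

    other-neighbour : ∀ {u a} → Adj Γ u a → ∃[ b ] Adj Γ u b × b ≢ a
    other-neighbour {u} = countFin-≡2⇒other (adj? Γ u) (trans (regular u) k≡2)

    unique-common : ∀ {x y} → x ≢ y → ¬ Adj Γ x y →
      ∀ {w w′} → Adj Γ x w → Adj Γ y w → Adj Γ x w′ → Adj Γ y w′ → w′ ≡ w
    unique-common {x} {y} x≢y x≁y x~w y~w x~w′ y~w′ =
      countFin-≡1⇒unique (adj? Γ x ∩? adj? Γ y) (trans (nonAdjacent-common x y x≢y x≁y) c≡1)
        (x~w , y~w) (x~w′ , y~w′)

    the-common-neighbour : ∀ {x y} → x ≢ y → ¬ Adj Γ x y → ∃[ w ] Adj Γ x w × Adj Γ y w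
    the-common-neighbour = common-neighbour (subst (0 <_) (≡.sym c≡1) (s≤s z≤n))

    -- The pentagon is x₀ p y₀ s q: s ≁ x₀ because p is the only common neighbour of x₀, y₀,
    -- and the common neighbour of x₀ and s can only be q.
    spanningPentagon : NonComplete Γ → SpanningPentagon Γ
    spanningPentagon (x₀ , y₀ , x₀≢y₀ , x₀≁y₀) with the-common-neighbour x₀≢y₀ x₀≁y₀
    ... | p , x₀~p , y₀~p with other-neighbour x₀~p | other-neighbour y₀~p
    ...   | q , x₀~q , q≢p | s , y₀~s , s≢p =
      record { corner = corner ; side = side ; spans = spans }
      where
      s≢x₀ : s ≢ x₀
      s≢x₀ s≡x₀ = x₀≁y₀ (Adj-sym (subst (Adj Γ y₀) s≡x₀ y₀~s))

      x₀≁s : ¬ Adj Γ x₀ s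
      x₀≁s x₀~s = s≢p (unique-common x₀≢y₀ x₀≁y₀ x₀~p y₀~p x₀~s y₀~s)

      q~s : Adj Γ q s
      q~s with the-common-neighbour (≢-sym s≢x₀) x₀≁s
      ... | t , x₀~t , s~t with neighbours x₀~p x₀~q q≢p x₀~t
      ...   | inj₁ refl = ⊥-elim (triangleFree (Adj-sym y₀~p) y₀~s (Adj-sym s~t))
      ...   | inj₂ refl = Adj-sym s~t

      corner : Fin 5 → V Γ
      corner zero                          = x₀
      corner (suc zero)                    = p
      corner (suc (suc zero))              = y₀
      corner (suc (suc (suc zero)))        = s
      corner (suc (suc (suc (suc zero))))  = q

      side : ∀ i → Adj Γ (corner i) (corner (next i))
      side zero                          = x₀~p
      side (suc zero)                    = Adj-sym y₀~p
      side (suc (suc zero))              = y₀~s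
      side (suc (suc (suc zero)))        = Adj-sym q~s
      side (suc (suc (suc (suc zero))))  = Adj-sym x₀~q

      at : ∀ {v} i → v ≡ corner i → ∃[ j ] corner j ≡ v
      at i v≡corner = i , ≡.sym v≡corner

      spans : ∀ v → ∃[ i ] corner i ≡ v
      spans v with v ≟ x₀
      ... | yes v≡x₀ = at zero v≡x₀
      ... | no v≢x₀ with adj? Γ x₀ v
      ...   | yes x₀~v = [ at (suc zero) , at (suc (suc (suc (suc zero)))) ]
                           (neighbours x₀~p x₀~q q≢p x₀~v)
      ...   | no x₀≁v with the-common-neighbour (≢-sym v≢x₀) x₀≁v
      ...     | t , x₀~t , v~t with neighbours x₀~p x₀~q q≢p x₀~t
      ...       | inj₁ refl = [ (λ v≡x₀ → contradiction v≡x₀ v≢x₀) , at (suc (suc zero)) ]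
                                (neighbours (Adj-sym x₀~p) (Adj-sym y₀~p) (≢-sym x₀≢y₀) (Adj-sym v~t))
      ...       | inj₂ refl = [ (λ v≡x₀ → contradiction v≡x₀ v≢x₀) , at (suc (suc (suc zero))) ]
                                (neighbours (Adj-sym x₀~q) q~s s≢x₀ (Adj-sym v~t))

m*c≡k*[k∸1]⇒k<m : ∀ {m c k} → 2 + c ≤ k → m * c ≡ k * (k ∸ 1) → k < m
m*c≡k*[k∸1]⇒k<m {m} {c} {suc k} (s≤s c<k) m*c≡k*[k∸1] = ≰⇒> λ m≤1+k → <-irrefl refl (begin-strict
  m * c      ≤⟨ *-monoˡ-≤ c m≤1+k ⟩
  suc k * c  <⟨ *-monoʳ-< (suc k) c<k ⟩
  suc k * k  ≡⟨ m*c≡k*[k∸1] ⟨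
  m * c      ∎)
  where open ≤-Reasoning

lemma4p2 : (Γ : Graph) → StronglyRegular Γ → NonComplete Γ → TwoArcTransitive Γ →
    CompleteBipartite Γ ⊎ (Γ ≅ C₅) ⊎ (∀ u → |Γ₁| Γ u < |Γ₂| Γ u)
lemma4p2 Γ (k , _ , c , connected , regular , _ , nonAdjacent-common) nc (_ , _ , arcTrans) =
  classify (m≤n⇒m<n∨m≡n (c≤k nc))
  where
  open GraphProperties Γ
  open SRGProperties Γ connected regular nonAdjacent-common

  triangleFree : TriangleFree Γ
  triangleFree = twoArcTransitive⇒triangleFree connected nc arcTrans

  classify : c < k ⊎ c ≡ k → CompleteBipartite Γ ⊎ (Γ ≅ C₅) ⊎ (∀ u → |Γ₁| Γ u < |Γ₂| Γ u)
  classify (inj₂ c≡k) = inj₁ (twins⇒completeBipartite triangleFree (c≡k⇒twins c≡k)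
                                (proj₂ (proj₂ (connected⇒edge connected nc))))
  classify (inj₁ c<k) with m≤n⇒m<n∨m≡n c<k
  ... | inj₂ 1+c≡k = inj₂ (inj₁ (spanningPentagon⇒≅C₅ triangleFree
          (spanningPentagon triangleFree (trans (≡.sym 1+c≡k) (cong suc c≡1)) c≡1 nc)))
    where
    c≡1 : c ≡ 1
    c≡1 = k≡1+c⇒c≡1 triangleFree nc (≡.sym 1+c≡k)
  ... | inj₁ 2+c≤k = inj₂ (inj₂ λ u → subst (_< |Γ₂| Γ u) (≡.sym (regular u))
          (m*c≡k*[k∸1]⇒k<m 2+c≤k (|Γ₂|*c≡k*[k∸1] triangleFree u)))
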